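{- For every positive integer $d$, there exists a Latin tableau $T$ such that the isotopy graph $\mathscr{G}(T)$ is isomorphic to the $d$-dimensional cube.
   Context: A partition $\lambda=(\lambda_1\ge\cdots\ge\lambda_k)$ of positive integers has Young diagram with left-justified rows, row $i$ of length $\lambda_i$. A Latin tableau of shape $\lambda$ fills the boxes with positive integers so that row $i$ contains each of $1,\dots,\lambda_i$ exactly once and no integer repeats in a column. Elementary transformations: swapping two rows of equal length, swapping two columns of equal length, or interchanging (everywhere in the tableau) two entries $x,y$ that occur equally often. Tableaux are isotopic if related by a finite sequence of elementary transformations; $\mathscr{G}(T)$ has as vertices the tableaux isotopic to $T$, two distinct vertices joined by a single edge if one is obtained from the other by one elementary transformation. The $d$-dimensional cube is the graph on $\{0,1\}^d$ with edges between tuples differing in exactly one coordinate. -}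

module Defs where

open import Data.Nat using (ℕ; zero; suc; _≤_; _<_; _≥_; _≡ᵇ_)
open import Data.Bool using (Bool; if_then_else_)
open import Data.List using (List; []; _∷_; length; map; upTo; applyUpTo; mapMaybe; filter; concat)
open import Data.List.Relation.Unary.All using (All)
open import Data.List.Relation.Unary.Linked using (Linked)
open import Data.List.Relation.Unary.Unique.Propositional using (Unique)
open import Data.List.Relation.Binary.Permutation.Propositional using (_↭_)
open import Data.Maybe using (Maybe; just; nothing)
open import Data.Vec using (Vec; lookup)
open import Data.Fin using (Fin)
open import Data.Product using (Σ; ∃; ∃-syntax; _×_; _,_)
open import Data.Sum using (_⊎_)
open import Relation.Binary.PropositionalEquality using (_≡_; _≢_)
open import Relation.Binary.Construct.Closure.ReflexiveTransitive using (Star)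
open import Data.Nat.Properties using (_≟_)
import Data.Nat as ℕ

-- A tableau is the list of its rows (row i = list of the entries of row i,
-- left to right).  Its shape is the list of row lengths.
Tableau : Set
Tableau = List (List ℕ)

nth : {A : Set} → List A → ℕ → Maybe A
nth []       _       = nothing
nth (x ∷ xs) zero    = just x
nth (x ∷ xs) (suc i) = nth xs i

row : Tableau → ℕ → List ℕ
row []       _       = []
row (r ∷ rs) zero    = r
row (r ∷ rs) (suc i) = row rs i

rowLen : Tableau → ℕ → ℕ
rowLen T i = length (row T i)

column : Tableau → ℕ → List ℕ
column T c = mapMaybe (λ r → nth r c) T

colLen : Tableau → ℕ → ℕ
colLen T c = length (column T c)

swapℕ : ℕ → ℕ → ℕ → ℕ
swapℕ a b k = if k ≡ᵇ a then b else (if k ≡ᵇ b then a else k)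

occ : Tableau → ℕ → ℕ
occ T x = length (filter (x ≟_) (concat T))

IsPartitionShape : Tableau → Set
IsPartitionShape T = All (λ r → 1 ≤ length r) T × Linked _≥_ (map length T)

LatinTableau : Tableau → Set
LatinTableau T =
  IsPartitionShape T
  × All (λ r → r ↭ applyUpTo suc (length r)) T
  × (∀ c → Unique (column T c))

swapRows : ℕ → ℕ → Tableau → Tableau
swapRows i j T = map (λ k → row T (swapℕ i j k)) (upTo (length T))

swapCols : ℕ → ℕ → Tableau → Tableau
swapCols a b T = map (λ r → mapMaybe (λ c → nth r (swapℕ a b c)) (upTo (length r))) T

swapEntries : ℕ → ℕ → Tableau → Tableau
swapEntries x y T = map (map (swapℕ x y)) T

data Elementary (T : Tableau) : Tableau → Set where
  rowSwap : ∀ i j → i < length T → j < length T → rowLen T i ≡ rowLen T j →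
            Elementary T (swapRows i j T)
  colSwap : ∀ a b → 1 ≤ colLen T a → 1 ≤ colLen T b → colLen T a ≡ colLen T b →
            Elementary T (swapCols a b T)
  entrySwap : ∀ x y → occ T x ≡ occ T y → Elementary T (swapEntries x y T)

Isotopic : Tableau → Tableau → Set
Isotopic = Star Elementary

Adjacent : Tableau → Tableau → Set
Adjacent S S' = S ≢ S' × Elementary S S'

CubeAdj : ∀ {d} → Vec Bool d → Vec Bool d → Set
CubeAdj {d} x y = ∃[ i ] (lookup x i ≢ lookup y i × (∀ (j : Fin d) → j ≢ i → lookup x j ≡ lookup y j))

IsoToCube : ℕ → Tableau → Set
IsoToCube d T =
  Σ (Vec Bool d → Tableau) λ f →
    (∀ x → Isotopic T (f x))
    × (∀ S → Isotopic T S → ∃[ x ] f x ≡ S)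
    × (∀ x y → f x ≡ f y → x ≡ y)
    × (∀ x y → (Adjacent (f x) (f y) → CubeAdj x y) × (CubeAdj x y → Adjacent (f x) (f y)))

-- For d = 1 take the single row (1 2).  For d ≥ 2 write d = 2m + top, where top = m
-- (even d) or top = m + 1 (odd d), and take rows of the odd lengths 2·top+1, …, 3, 1.
-- Every column w and every entry w+1 then meets exactly top+1-⌊(w+1)/2⌋ rows, so the
-- only nontrivial elementary transformations exchange the two columns, or the two
-- entries, of one "pair" {2j+2, 2j+3}; rows all have different lengths.  A vertex is
-- obtained from a base tableau by exchanging the column pairs j < m and the entry
-- pairs k < top selected by a point of {0,1}^d, and such transformations commute.
-- When top = m + 1 the column pair m meets only the first row, where exchanging it
-- coincides with exchanging the entry pair m; the first row is chosen for this.

module Submission where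

open import Defs
open import Data.Nat using (ℕ; zero; suc; pred; _+_; _∸_; _≤_; _<_; _≥_; _≡ᵇ_; _<ᵇ_; z≤n; s≤s)
open import Data.Nat.Properties
  using (_≟_; _<?_; ≤-refl; ≤-trans; ≤-antisym; n≤1+n; <⇒<ᵇ; <ᵇ⇒<; ≡ᵇ⇒≡; suc-injective; <⇒≤; ≮⇒≥; ≰⇒>;
         +-∸-assoc; m≤n⇒m∸n≡0; 0∸n≡0; ∸-cancelˡ-≡; m<1+n⇒m≤n; m+n≡0⇒m≡0; m+n≡0⇒n≡0;
         <⇒≢; ∸-monoʳ-≤; _≤?_; ≤-reflexive; <-≤-trans; m≤m+n; +-monoʳ-<; m∸n≢0⇒n<m; n>0⇒n≢0;
         m<n⇒0<n∸m; m+[n∸m]≡n; +-cancelˡ-<; m≤n⇒m≤1+n; m∸n+n≡m; 1+n≰n; +-suc; 1+n≢n)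
open import Data.Bool using (Bool; true; false; not; _∧_; _xor_; if_then_else_)
open import Data.Bool.Properties using (T-≡; xor-same; xor-identityʳ; xor-comm; not-¬; ¬-not; ∧-zeroʳ)
open import Data.List
  using (List; []; _∷_; length; map; upTo; applyUpTo; mapMaybe; filter; concat; catMaybes; _++_)
open import Data.List.Properties
  using (∷-injective; length-map; map-cong; map-id; map-applyUpTo; length-applyUpTo; length-++; filter-++;
         map-++; ++-assoc; applyUpTo-∷ʳ)
open import Data.List.Relation.Unary.All using (All; []; _∷_)
import Data.List.Relation.Unary.All as All
open import Data.List.Relation.Unary.Unique.Propositional using (Unique)
open import Data.List.Relation.Unary.AllPairs using ([]; _∷_)
open import Data.List.Relation.Unary.Linked using (Linked; [-]; _∷_)
open import Data.List.Relation.Binary.Permutation.Propositional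
  using (_↭_; module PermutationReasoning; prep; swap; ↭-refl; ↭-trans; ↭-reflexive)
open import Data.List.Relation.Binary.Permutation.Propositional.Properties
  using (filter-↭; ↭-length; map⁺; ++⁺; ∷↭∷ʳ)
open import Data.Maybe using (Maybe; just; nothing)
open import Data.Maybe.Properties using (just-injective)
open import Data.Vec using (Vec; []; _∷_; updateAt; lookup; replicate)
open import Data.Vec.Properties using (lookup∘updateAt; lookup∘updateAt′; tabulate∘lookup; tabulate-cong)
open import Data.Fin using (Fin; toℕ; fromℕ<)
import Data.Fin as Fin
open import Data.Fin.Properties using (toℕ-fromℕ<; fromℕ<-toℕ; fromℕ<-cong; toℕ<n)
open import Data.Product using (∃-syntax; _×_; _,_; proj₁; proj₂)
open import Data.Sum using (_⊎_; inj₁; inj₂; [_,_]′)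
open import Data.Empty using (⊥-elim)
open import Function using (_∘_; id; Equivalence)
open import Relation.Nullary using (yes; no)
open import Relation.Unary using (_⊆_)
open import Relation.Binary.Construct.Closure.ReflexiveTransitive using (_◅_; _◅◅_)
  renaming (ε to ε⋆)
open import Relation.Binary.PropositionalEquality
  using (_≡_; _≢_; refl; sym; trans; cong; cong₂; subst; module ≡-Reasoning)

<⇒<ᵇ≡true : ∀ {m n} → m < n → (m <ᵇ n) ≡ true
<⇒<ᵇ≡true p = Equivalence.to T-≡ (<⇒<ᵇ p)

<ᵇ≡true⇒< : ∀ m n → (m <ᵇ n) ≡ true → m < n
<ᵇ≡true⇒< m n e = <ᵇ⇒< m n (Equivalence.from T-≡ e)

≥⇒<ᵇ≡false : ∀ m n → n ≤ m → (m <ᵇ n) ≡ false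
≥⇒<ᵇ≡false m       zero    _       = refl
≥⇒<ᵇ≡false (suc m) (suc n) (s≤s p) = ≥⇒<ᵇ≡false m n p

<ᵇ≡false⇒≥ : ∀ m n → (m <ᵇ n) ≡ false → n ≤ m
<ᵇ≡false⇒≥ m       zero    _ = z≤n
<ᵇ≡false⇒≥ (suc m) (suc n) e = s≤s (<ᵇ≡false⇒≥ m n e)

≡ᵇ≡true⇒≡ : ∀ m n → (m ≡ᵇ n) ≡ true → m ≡ n
≡ᵇ≡true⇒≡ m n e = ≡ᵇ⇒≡ m n (Equivalence.from T-≡ e)

≢⇒≡ᵇ≡false : ∀ m n → m ≢ n → (m ≡ᵇ n) ≡ false
≢⇒≡ᵇ≡false m n m≢n with m ≡ᵇ n in e
... | true  = ⊥-elim (m≢n (≡ᵇ≡true⇒≡ m n e))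
... | false = refl

≡ᵇ-refl : ∀ n → (n ≡ᵇ n) ≡ true
≡ᵇ-refl zero    = refl
≡ᵇ-refl (suc n) = ≡ᵇ-refl n

nth-applyUpTo : ∀ (f : ℕ → ℕ) L c → nth (applyUpTo f L) c ≡ (if c <ᵇ L then just (f c) else nothing)
nth-applyUpTo f zero    c       = refl
nth-applyUpTo f (suc L) zero    = refl
nth-applyUpTo f (suc L) (suc c) = nth-applyUpTo (f ∘ suc) L c

nth-applyUpTo-< : ∀ (f : ℕ → ℕ) L c → c < L → nth (applyUpTo f L) c ≡ just (f c)
nth-applyUpTo-< f L c c<L rewrite nth-applyUpTo f L c | <⇒<ᵇ≡true c<L = refl

applyUpTo-cong : ∀ (f g : ℕ → ℕ) L → (∀ c → c < L → f c ≡ g c) → applyUpTo f L ≡ applyUpTo g L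
applyUpTo-cong f g zero    _ = refl
applyUpTo-cong f g (suc L) p =
  cong₂ _∷_ (p 0 (s≤s z≤n)) (applyUpTo-cong (f ∘ suc) (g ∘ suc) L (λ c q → p (suc c) (s≤s q)))

catMaybes-justs : ∀ (h : ℕ → Maybe ℕ) (k : ℕ → ℕ) L → (∀ c → c < L → h c ≡ just (k c)) →
                  catMaybes (applyUpTo h L) ≡ applyUpTo k L
catMaybes-justs h k zero    _ = refl
catMaybes-justs h k (suc L) p with h 0 | p 0 (s≤s z≤n)
... | .(just (k 0)) | refl =
  cong (k 0 ∷_) (catMaybes-justs (h ∘ suc) (k ∘ suc) L (λ c q → p (suc c) (s≤s q)))

catMaybes-nth : ∀ (r : List ℕ) → catMaybes (applyUpTo (nth r) (length r)) ≡ r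
catMaybes-nth []      = refl
catMaybes-nth (x ∷ r) = cong (x ∷_) (catMaybes-nth r)

applyUpTo-row : ∀ (T : Tableau) → applyUpTo (row T) (length T) ≡ T
applyUpTo-row []      = refl
applyUpTo-row (r ∷ T) = cong (r ∷_) (applyUpTo-row T)

swapℕ-same : ∀ a k → swapℕ a a k ≡ k
swapℕ-same a k with k ≡ᵇ a in e
... | true  = sym (≡ᵇ≡true⇒≡ k a e)
... | false = refl

swapℕ-fixes : ∀ a b k → k ≢ a → k ≢ b → swapℕ a b k ≡ k
swapℕ-fixes a b k k≢a k≢b rewrite ≢⇒≡ᵇ≡false k a k≢a | ≢⇒≡ᵇ≡false k b k≢b = refl

swapℕ-suc : ∀ a b k → suc (swapℕ a b k) ≡ swapℕ (suc a) (suc b) (suc k)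
swapℕ-suc a b k with k ≡ᵇ a
... | true  = refl
... | false with k ≡ᵇ b
...   | true  = refl
...   | false = refl

swapRows-same : ∀ i T → swapRows i i T ≡ T
swapRows-same i T = begin
  map (λ k → row T (swapℕ i i k)) (upTo (length T))
    ≡⟨ map-cong (λ k → cong (row T) (swapℕ-same i k)) (upTo (length T)) ⟩
  map (row T) (upTo (length T))  ≡⟨ map-applyUpTo id (row T) (length T) ⟩
  applyUpTo (row T) (length T)   ≡⟨ applyUpTo-row T ⟩
  T                              ∎
  where open ≡-Reasoning

swapCols-same : ∀ a T → swapCols a a T ≡ T
swapCols-same a []      = refl
swapCols-same a (r ∷ T) = cong₂ _∷_ rowEq (swapCols-same a T)
  where
  open ≡-Reasoning
  rowEq : mapMaybe (λ c → nth r (swapℕ a a c)) (upTo (length r)) ≡ r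
  rowEq = begin
    catMaybes (map (λ c → nth r (swapℕ a a c)) (upTo (length r)))
      ≡⟨ cong catMaybes (map-cong (λ c → cong (nth r) (swapℕ-same a c)) (upTo (length r))) ⟩
    catMaybes (map (nth r) (upTo (length r)))
      ≡⟨ cong catMaybes (map-applyUpTo id (nth r) (length r)) ⟩
    catMaybes (applyUpTo (nth r) (length r))
      ≡⟨ catMaybes-nth r ⟩
    r ∎

swapEntries-same : ∀ x T → swapEntries x x T ≡ T
swapEntries-same x T = trans (map-cong (λ r → trans (map-cong (swapℕ-same x) r) (map-id r)) T) (map-id T)

ind : Bool → ℕ
ind true  = 1
ind false = 0

count : ℕ → List ℕ → ℕ
count v xs = length (filter (v ≟_) xs)

count-↭ : ∀ v {xs ys} → xs ↭ ys → count v xs ≡ count v ys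
count-↭ v p = ↭-length (filter-↭ (v ≟_) p)

count-suc-map-suc : ∀ w xs → count (suc w) (map suc xs) ≡ count w xs
count-suc-map-suc w []       = refl
count-suc-map-suc w (x ∷ xs) with w ≡ᵇ x
... | true  = cong suc (count-suc-map-suc w xs)
... | false = count-suc-map-suc w xs

count-0-map-suc : ∀ xs → count 0 (map suc xs) ≡ 0
count-0-map-suc []       = refl
count-0-map-suc (x ∷ xs) = count-0-map-suc xs

count-upTo : ∀ w L → count w (upTo L) ≡ ind (w <ᵇ L)
count-upTo w       zero    = refl
count-upTo zero    (suc L) = cong suc (trans (cong (count 0) (sym (map-applyUpTo id suc L))) (count-0-map-suc (upTo L)))
count-upTo (suc w) (suc L) =
  trans (cong (count (suc w)) (sym (map-applyUpTo id suc L))) (trans (count-suc-map-suc w (upTo L)) (count-upTo w L))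

range1 : ℕ → List ℕ
range1 L = applyUpTo suc L

count-suc-range1 : ∀ w L → count (suc w) (range1 L) ≡ ind (w <ᵇ L)
count-suc-range1 w L =
  trans (cong (count (suc w)) (sym (map-applyUpTo id suc L))) (trans (count-suc-map-suc w (upTo L)) (count-upTo w L))

count-0-range1 : ∀ L → count 0 (range1 L) ≡ 0
count-0-range1 L = trans (cong (count 0) (sym (map-applyUpTo id suc L))) (count-0-map-suc (upTo L))

occ-∷ : ∀ r T v → occ (r ∷ T) v ≡ count v r + occ T v
occ-∷ r T v = trans (cong length (filter-++ (v ≟_) r (concat T))) (length-++ (filter (v ≟_) r))

-- Tableaux described row by row: a list of row descriptions δ, row δ having length
-- len δ and entries G δ 0, …, G δ (len δ - 1).  Elementary transformations of such a
-- tableau act on the entry function G, and its column lengths and entry counts only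
-- depend on the row lengths.

module Tabulated {D : Set} (len : D → ℕ) where

  tab : (D → ℕ → ℕ) → List D → Tableau
  tab G Ds = map (λ δ → applyUpTo (G δ) (len δ)) Ds

  tab-cong : ∀ G G' Ds → All (λ δ → ∀ c → c < len δ → G δ c ≡ G' δ c) Ds → tab G Ds ≡ tab G' Ds
  tab-cong G G' []       []       = refl
  tab-cong G G' (δ ∷ Ds) (p ∷ ps) = cong₂ _∷_ (applyUpTo-cong (G δ) (G' δ) (len δ) p) (tab-cong G G' Ds ps)

  swapCols-tab : ∀ u v G Ds → All (λ δ → ∀ c → c < len δ → swapℕ u v c < len δ) Ds →
                 swapCols u v (tab G Ds) ≡ tab (λ δ c → G δ (swapℕ u v c)) Ds
  swapCols-tab u v G []       []       = refl
  swapCols-tab u v G (δ ∷ Ds) (p ∷ ps) = cong₂ _∷_ rowEq (swapCols-tab u v G Ds ps)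
    where
    open ≡-Reasoning
    r : List ℕ
    r = applyUpTo (G δ) (len δ)
    rowEq : mapMaybe (λ c → nth r (swapℕ u v c)) (upTo (length r))
            ≡ applyUpTo (λ c → G δ (swapℕ u v c)) (len δ)
    rowEq rewrite length-applyUpTo (G δ) (len δ) = begin
      catMaybes (map (λ c → nth r (swapℕ u v c)) (upTo (len δ)))
        ≡⟨ cong catMaybes (map-applyUpTo id (λ c → nth r (swapℕ u v c)) (len δ)) ⟩
      catMaybes (applyUpTo (λ c → nth r (swapℕ u v c)) (len δ))
        ≡⟨ catMaybes-justs _ _ (len δ) (λ c q → nth-applyUpTo-< (G δ) (len δ) (swapℕ u v c) (p c q)) ⟩
      applyUpTo (λ c → G δ (swapℕ u v c)) (len δ) ∎

  swapEntries-tab : ∀ x y G Ds → swapEntries x y (tab G Ds) ≡ tab (λ δ c → swapℕ x y (G δ c)) Ds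
  swapEntries-tab x y G []       = refl
  swapEntries-tab x y G (δ ∷ Ds) =
    cong₂ _∷_ (map-applyUpTo (G δ) (swapℕ x y) (len δ)) (swapEntries-tab x y G Ds)

  colCount : List D → ℕ → ℕ
  colCount []       c = 0
  colCount (δ ∷ Ds) c = ind (c <ᵇ len δ) + colCount Ds c

  colLen-tab : ∀ G Ds c → colLen (tab G Ds) c ≡ colCount Ds c
  colLen-tab G []       c = refl
  colLen-tab G (δ ∷ Ds) c with c <ᵇ len δ | nth-applyUpTo (G δ) (len δ) c
  ... | true  | e rewrite e = cong suc (colLen-tab G Ds c)
  ... | false | e rewrite e = colLen-tab G Ds c

  -- Rows that are permutations of [1..len δ]: the entry w+1 occurs once in each row
  -- longer than w, so as often as column w has entries; 0 never occurs.
  RowsArePerms : (D → ℕ → ℕ) → List D → Set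
  RowsArePerms G Ds = All (λ δ → applyUpTo (G δ) (len δ) ↭ range1 (len δ)) Ds

  occ-tab-suc : ∀ G Ds w → RowsArePerms G Ds → occ (tab G Ds) (suc w) ≡ colCount Ds w
  occ-tab-suc G []       w []       = refl
  occ-tab-suc G (δ ∷ Ds) w (p ∷ ps) =
    trans (occ-∷ (applyUpTo (G δ) (len δ)) (tab G Ds) (suc w))
      (cong₂ _+_ (trans (count-↭ (suc w) p) (count-suc-range1 w (len δ))) (occ-tab-suc G Ds w ps))

  occ-tab-0 : ∀ G Ds → RowsArePerms G Ds → occ (tab G Ds) 0 ≡ 0
  occ-tab-0 G []       []       = refl
  occ-tab-0 G (δ ∷ Ds) (p ∷ ps) =
    trans (occ-∷ (applyUpTo (G δ) (len δ)) (tab G Ds) 0)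
      (cong₂ _+_ (trans (count-↭ 0 p) (count-0-range1 (len δ))) (occ-tab-0 G Ds ps))

  colList : (D → ℕ → ℕ) → List D → ℕ → List ℕ
  colList G []       c = []
  colList G (δ ∷ Ds) c = if c <ᵇ len δ then G δ c ∷ colList G Ds c else colList G Ds c

  column-tab : ∀ G Ds c → column (tab G Ds) c ≡ colList G Ds c
  column-tab G []       c = refl
  column-tab G (δ ∷ Ds) c with c <ᵇ len δ | nth-applyUpTo (G δ) (len δ) c
  ... | true  | e rewrite e = cong (G δ c ∷_) (column-tab G Ds c)
  ... | false | e rewrite e = column-tab G Ds c

  lenAt : List D → ℕ → ℕ
  lenAt []       i       = 0
  lenAt (δ ∷ Ds) zero    = len δ
  lenAt (δ ∷ Ds) (suc i) = lenAt Ds i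

  rowLen-tab : ∀ G Ds i → rowLen (tab G Ds) i ≡ lenAt Ds i
  rowLen-tab G []       i       = refl
  rowLen-tab G (δ ∷ Ds) zero    = length-applyUpTo (G δ) (len δ)
  rowLen-tab G (δ ∷ Ds) (suc i) = rowLen-tab G Ds i

  map-length-tab : ∀ G Ds → map length (tab G Ds) ≡ map len Ds
  map-length-tab G []       = refl
  map-length-tab G (δ ∷ Ds) = cong₂ _∷_ (length-applyUpTo (G δ) (len δ)) (map-length-tab G Ds)

  All-tab : ∀ {Q : D → Set} {R : List ℕ → Set} G Ds →
            (∀ {δ} → Q δ → R (applyUpTo (G δ) (len δ))) → All Q Ds → All R (tab G Ds)
  All-tab G []       f []       = []
  All-tab G (δ ∷ Ds) f (q ∷ qs) = f q ∷ All-tab G Ds f qs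

-- Entries and columns of the
-- tableaux below are permuted by exchanging the two elements of chosen pairs.

half : ℕ → ℕ
half zero          = zero
half (suc zero)    = zero
half (suc (suc n)) = suc (half n)

partner : ℕ → ℕ
partner zero          = 1
partner (suc zero)    = 0
partner (suc (suc n)) = suc (suc (partner n))

dbl : ℕ → ℕ
dbl zero    = zero
dbl (suc k) = suc (suc (dbl k))

odd : ℕ → ℕ
odd k = suc (dbl k)

dbl-mono : ∀ {h k} → h ≤ k → dbl h ≤ dbl k
dbl-mono z≤n     = z≤n
dbl-mono (s≤s p) = s≤s (s≤s (dbl-mono p))

half-dbl : ∀ k → half (dbl k) ≡ k
half-dbl zero    = refl
half-dbl (suc k) = cong suc (half-dbl k)

half-odd : ∀ k → half (odd k) ≡ k
half-odd zero    = refl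
half-odd (suc k) = cong suc (half-odd k)

dbl-injective : ∀ x y → dbl x ≡ dbl y → x ≡ y
dbl-injective x y e = trans (sym (half-dbl x)) (trans (cong half e) (half-dbl y))

odd-injective : ∀ x y → odd x ≡ odd y → x ≡ y
odd-injective x y e = dbl-injective x y (suc-injective e)

partner-dbl : ∀ k → partner (dbl k) ≡ odd k
partner-dbl zero    = refl
partner-dbl (suc k) = cong (suc ∘ suc) (partner-dbl k)

partner-odd : ∀ k → partner (odd k) ≡ dbl k
partner-odd zero    = refl
partner-odd (suc k) = cong (suc ∘ suc) (partner-odd k)

half-partner : ∀ n → half (partner n) ≡ half n
half-partner zero          = refl
half-partner (suc zero)    = refl
half-partner (suc (suc n)) = cong suc (half-partner n)

partner-involutive : ∀ n → partner (partner n) ≡ n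
partner-involutive zero          = refl
partner-involutive (suc zero)    = refl
partner-involutive (suc (suc n)) = cong (suc ∘ suc) (partner-involutive n)

partner-≢ : ∀ n → partner n ≢ n
partner-≢ zero          ()
partner-≢ (suc zero)    ()
partner-≢ (suc (suc n)) e = partner-≢ n (suc-injective (suc-injective e))

same-pair : ∀ n u → half n ≡ half u → n ≡ u ⊎ n ≡ partner u
same-pair zero          zero          _ = inj₁ refl
same-pair zero          (suc zero)    _ = inj₂ refl
same-pair (suc zero)    zero          _ = inj₂ refl
same-pair (suc zero)    (suc zero)    _ = inj₁ refl
same-pair (suc (suc n)) (suc (suc u)) e with same-pair n u (suc-injective e)
... | inj₁ p = inj₁ (cong (suc ∘ suc) p)
... | inj₂ p = inj₂ (cong (suc ∘ suc) p)

≤odd⇒half≤ : ∀ n k → n ≤ odd k → half n ≤ k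
≤odd⇒half≤ zero          k       _               = z≤n
≤odd⇒half≤ (suc zero)    k       _               = z≤n
≤odd⇒half≤ (suc (suc n)) (suc k) (s≤s (s≤s p)) = s≤s (≤odd⇒half≤ n k p)

half≤⇒≤odd : ∀ n k → half n ≤ k → n ≤ odd k
half≤⇒≤odd zero          k       _       = z≤n
half≤⇒≤odd (suc zero)    k       _       = s≤s z≤n
half≤⇒≤odd (suc (suc n)) (suc k) (s≤s p) = s≤s (s≤s (half≤⇒≤odd n k p))

flipIf : Bool → ℕ → ℕ
flipIf true  n = partner n
flipIf false n = n

half-flipIf : ∀ b n → half (flipIf b n) ≡ half n
half-flipIf true  n = half-partner n
half-flipIf false n = refl

flipIf-flipIf : ∀ b c n → flipIf b (flipIf c n) ≡ flipIf (b xor c) n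
flipIf-flipIf true  true  n = partner-involutive n
flipIf-flipIf true  false n = refl
flipIf-flipIf false c     n = refl

flipIf-injective : ∀ b b' n → flipIf b n ≡ flipIf b' n → b ≡ b'
flipIf-injective true  true  n _ = refl
flipIf-injective false false n _ = refl
flipIf-injective true  false n e = ⊥-elim (partner-≢ n e)
flipIf-injective false true  n e = ⊥-elim (partner-≢ n (sym e))

-- A bit vector β : ℕ → Bool controls the pairs 1, 2, 3, …: pair j+1 = {2j+2, 2j+3} is
-- exchanged iff β j.  Pair 0 = {0,1} is never touched, so 1 stays fixed.
pairBit : (ℕ → Bool) → ℕ → Bool
pairBit β zero    = false
pairBit β (suc j) = β j

flipPairs : (ℕ → Bool) → ℕ → ℕ
flipPairs β n = flipIf (pairBit β (half n)) n

_⊕_ : (ℕ → Bool) → (ℕ → Bool) → ℕ → Bool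
(β ⊕ γ) j = β j xor γ j

single : ℕ → ℕ → Bool
single j k = k ≡ᵇ j

zeros : ℕ → Bool
zeros _ = false

half-flipPairs : ∀ β n → half (flipPairs β n) ≡ half n
half-flipPairs β n = half-flipIf (pairBit β (half n)) n

flipPairs-cong : ∀ β γ n → (∀ j → suc j ≡ half n → β j ≡ γ j) → flipPairs β n ≡ flipPairs γ n
flipPairs-cong β γ n p with half n
... | zero  = refl
... | suc j = cong (λ b → flipIf b n) (p j refl)

flipPairs-∘ : ∀ β γ n → flipPairs β (flipPairs γ n) ≡ flipPairs (β ⊕ γ) n
flipPairs-∘ β γ n rewrite half-flipIf (pairBit γ (half n)) n with half n
... | zero  = refl
... | suc j = flipIf-flipIf (β j) (γ j) n

flipPairs-zeros : ∀ n → flipPairs zeros n ≡ n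
flipPairs-zeros n with half n
... | zero  = refl
... | suc j = refl

flipPairs-involutive : ∀ β n → flipPairs β (flipPairs β n) ≡ n
flipPairs-involutive β n = begin
  flipPairs β (flipPairs β n) ≡⟨ flipPairs-∘ β β n ⟩
  flipPairs (β ⊕ β) n         ≡⟨ flipPairs-cong (β ⊕ β) zeros n (λ j _ → xor-same (β j)) ⟩
  flipPairs zeros n           ≡⟨ flipPairs-zeros n ⟩
  n                           ∎
  where open ≡-Reasoning

flipPairs-injective : ∀ β n n' → flipPairs β n ≡ flipPairs β n' → n ≡ n'
flipPairs-injective β n n' e =
  trans (sym (flipPairs-involutive β n)) (trans (cong (flipPairs β) e) (flipPairs-involutive β n'))

flipPairs-dbl : ∀ β k → flipPairs β (dbl (suc k)) ≡ flipIf (β k) (dbl (suc k))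
flipPairs-dbl β k rewrite half-dbl k = refl

flipPairs-odd : ∀ β k → flipPairs β (odd (suc k)) ≡ flipIf (β k) (odd (suc k))
flipPairs-odd β k rewrite half-odd k = refl

swapℕ-pair : ∀ x y j n → half x ≡ suc j → half y ≡ suc j → x ≢ y → swapℕ x y n ≡ flipPairs (single j) n
swapℕ-pair x y j n hx hy x≢y with same-pair y x (trans hy (sym hx))
... | inj₁ y≡x = ⊥-elim (x≢y (sym y≡x))
... | inj₂ refl with n ≡ᵇ x in e₁
...   | true rewrite ≡ᵇ≡true⇒≡ n x e₁ | hx | ≡ᵇ-refl j = refl
...   | false with n ≡ᵇ partner x in e₂
...     | true rewrite ≡ᵇ≡true⇒≡ n (partner x) e₂ | half-partner x | hx | ≡ᵇ-refl j =
          sym (partner-involutive x)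
...     | false = sym (trans (flipPairs-cong (single j) zeros n outside) (flipPairs-zeros n))
  where
  outside : ∀ i → suc i ≡ half n → single j i ≡ false
  outside i e = ≢⇒≡ᵇ≡false i j λ { refl →
    [ differs e₁ , differs e₂ ]′ (same-pair n x (trans (sym e) (sym hx))) }
    where
    differs : ∀ {z} → (n ≡ᵇ z) ≡ false → n ≢ z
    differs e' refl with trans (sym e') (≡ᵇ-refl n)
    ... | ()

-- Maps permuting [1..L].  Each is checked by cutting [1..L] into consecutive blocks
-- that the map permutes.

range1-suc : ∀ n → range1 (suc n) ≡ range1 n ++ suc n ∷ []
range1-suc n = sym (applyUpTo-∷ʳ suc n)

range1-+2 : ∀ n → range1 (suc (suc n)) ≡ range1 n ++ suc n ∷ suc (suc n) ∷ []
range1-+2 n = trans (range1-suc (suc n))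
  (trans (cong (_++ suc (suc n) ∷ []) (range1-suc n)) (++-assoc (range1 n) (suc n ∷ []) (suc (suc n) ∷ [])))

FixesOrSwaps : (ℕ → ℕ) → ℕ → ℕ → Set
FixesOrSwaps h x y = (h x ≡ x × h y ≡ y) ⊎ (h x ≡ y × h y ≡ x)

↭-extend-pair : ∀ (h : ℕ → ℕ) xs x y → map h xs ↭ xs → FixesOrSwaps h x y →
                map h (xs ++ x ∷ y ∷ []) ↭ xs ++ x ∷ y ∷ []
↭-extend-pair h xs x y p q = ↭-trans (↭-reflexive (map-++ h xs (x ∷ y ∷ []))) (++⁺ p (last q))
  where
  last : FixesOrSwaps h x y → h x ∷ h y ∷ [] ↭ x ∷ y ∷ []
  last (inj₁ (e₁ , e₂)) rewrite e₁ | e₂ = ↭-refl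
  last (inj₂ (e₁ , e₂)) rewrite e₁ | e₂ = swap y x ↭-refl

flipPairs-on-pair : ∀ β k → FixesOrSwaps (flipPairs β) (dbl (suc k)) (odd (suc k))
flipPairs-on-pair β k rewrite flipPairs-dbl β k | flipPairs-odd β k with β k
... | true  = inj₂ (partner-dbl (suc k) , partner-odd (suc k))
... | false = inj₁ (refl , refl)

flipPairs-↭ : ∀ β k → map (flipPairs β) (range1 (odd k)) ↭ range1 (odd k)
flipPairs-↭ β zero    = ↭-refl
flipPairs-↭ β (suc k) = subst (λ xs → map (flipPairs β) xs ↭ xs) (sym (range1-+2 (odd k)))
  (↭-extend-pair (flipPairs β) _ _ _ (flipPairs-↭ β k) (flipPairs-on-pair β k))

reverse-↭ : ∀ L → map (λ C → suc L ∸ C) (range1 L) ↭ range1 L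
reverse-↭ L = ↭-trans (↭-reflexive (map-applyUpTo suc (λ C → suc L ∸ C) L)) (downwards L)
  where
  downwards : ∀ L → applyUpTo (λ c → L ∸ c) L ↭ range1 L
  downwards zero    = ↭-refl
  downwards (suc L) = ↭-trans (prep (suc L) (downwards L))
                        (↭-trans (∷↭∷ʳ (suc L) (range1 L)) (↭-reflexive (applyUpTo-∷ʳ suc L)))

-- For ε : Bool and m : ℕ the shape consists of rows of the odd
-- lengths 2m+1, 2m-1, …, 3, 1, preceded (if ε) by a special row of length 2m+3; its
-- isotopy graph is the cube of dimension m + top ε m.  A row is described by
-- (special?, length).

RowSpec : Set
RowSpec = Bool × ℕ

len : RowSpec → ℕ
len = proj₂

open Tabulated len

staircase : ℕ → List RowSpec
staircase zero    = (false , 1) ∷ []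
staircase (suc k) = (false , odd (suc k)) ∷ staircase k

shape : Bool → ℕ → List RowSpec
shape false m = staircase m
shape true  m = (true , odd (suc m)) ∷ staircase m

-- The first row has length odd (top ε m); there are top ε m + 1 rows.
top : Bool → ℕ → ℕ
top false m = m
top true  m = suc m

-- The special row 2 1 4 3 … 2m 2m-1 (2m+1) (2m+2) (2m+3), as a function of the
-- 1-based column C.
special : ℕ → ℕ → ℕ
special m C = if half (pred C) <ᵇ m then suc (partner (pred C)) else C

base : ℕ → Bool → ℕ → ℕ → ℕ
base m false L C = suc L ∸ C
base m true  L C = special m C

-- The vertex with column-pair bits α and entry-pair bits β: in the base tableau,
-- exchange the 1-based columns 2j+2, 2j+3 when α j and the entries 2k+2, 2k+3 when β k.
entry : ℕ → (ℕ → Bool) → (ℕ → Bool) → RowSpec → ℕ → ℕ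
entry m α β (E , L) c = flipPairs β (base m E L (flipPairs α (suc c)))

tableau : Bool → ℕ → (ℕ → Bool) → (ℕ → Bool) → Tableau
tableau ε m α β = tab (entry m α β) (shape ε m)

range1-+3 : ∀ n → range1 (suc (suc (suc n))) ≡ range1 n ++ suc n ∷ suc (suc n) ∷ suc (suc (suc n)) ∷ []
range1-+3 n = trans (range1-suc (suc (suc n)))
  (trans (cong (_++ suc (suc (suc n)) ∷ []) (range1-+2 n))
         (++-assoc (range1 n) (suc n ∷ suc (suc n) ∷ []) (suc (suc (suc n)) ∷ [])))

special-fixes : ∀ m C → m ≤ half (pred C) → special m C ≡ C
special-fixes m C p rewrite ≥⇒<ᵇ≡false (half (pred C)) m p = refl

-- The special row permutes [1..2m+3]: it exchanges 2i+1, 2i+2 for i < m and fixes the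
-- last three entries.
special-↭ : ∀ m → map (special m) (range1 (odd (suc m))) ↭ range1 (odd (suc m))
special-↭ m = subst (λ xs → map (special m) xs ↭ xs) (sym (range1-+3 (dbl m)))
  (↭-trans (↭-reflexive (map-++ (special m) (range1 (dbl m)) _)) (++⁺ (pairs m ≤-refl) (↭-reflexive fixed)))
  where
  pairs : ∀ k → k ≤ m → map (special m) (range1 (dbl k)) ↭ range1 (dbl k)
  pairs zero    _   = ↭-refl
  pairs (suc k) k<m = subst (λ xs → map (special m) xs ↭ xs) (sym (range1-+2 (dbl k)))
    (↭-extend-pair (special m) _ _ _ (pairs k (≤-trans (n≤1+n k) k<m)) (inj₂ (swaps₁ , swaps₂)))
    where
    swaps₁ : special m (suc (dbl k)) ≡ suc (suc (dbl k))
    swaps₁ rewrite half-dbl k | <⇒<ᵇ≡true k<m | partner-dbl k = refl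
    swaps₂ : special m (suc (suc (dbl k))) ≡ suc (dbl k)
    swaps₂ rewrite half-odd k | <⇒<ᵇ≡true k<m | partner-odd k = refl
  fixed : map (special m) (suc (dbl m) ∷ suc (suc (dbl m)) ∷ suc (suc (suc (dbl m))) ∷ [])
          ≡ suc (dbl m) ∷ suc (suc (dbl m)) ∷ suc (suc (suc (dbl m))) ∷ []
  fixed rewrite special-fixes m (suc (dbl m)) (subst (m ≤_) (sym (half-dbl m)) ≤-refl)
              | special-fixes m (suc (suc (dbl m))) (subst (m ≤_) (sym (half-odd m)) ≤-refl)
              | special-fixes m (suc (suc (suc (dbl m)))) (subst (m ≤_) (sym (half-dbl (suc m))) (n≤1+n m)) = refl

row-↭ : ∀ (f g h : ℕ → ℕ) L → map f (range1 L) ↭ range1 L → map g (range1 L) ↭ range1 L →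
        map h (range1 L) ↭ range1 L → applyUpTo (λ c → h (g (f (suc c)))) L ↭ range1 L
row-↭ f g h L pf pg ph = begin
  applyUpTo (λ c → h (g (f (suc c)))) L  ≡⟨ sym (map-applyUpTo (g ∘ f ∘ suc) h L) ⟩
  map h (applyUpTo (g ∘ f ∘ suc) L)       ≡⟨ cong (map h) (sym (map-applyUpTo (f ∘ suc) g L)) ⟩
  map h (map g (applyUpTo (f ∘ suc) L))   ≡⟨ cong (map h ∘ map g) (sym (map-applyUpTo suc f L)) ⟩
  map h (map g (map f (range1 L)))        ↭⟨ map⁺ h (map⁺ g pf) ⟩
  map h (map g (range1 L))                ↭⟨ map⁺ h pg ⟩
  map h (range1 L)                        ↭⟨ ph ⟩
  range1 L                                ∎
  where open PermutationReasoning

rows-↭ : ∀ ε m α β → RowsArePerms (entry m α β) (shape ε m)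
rows-↭ ε m α β = rows ε
  where
  ordinary : ∀ k → applyUpTo (entry m α β (false , odd k)) (odd k) ↭ range1 (odd k)
  ordinary k = row-↭ _ _ _ (odd k) (flipPairs-↭ α k) (reverse-↭ (odd k)) (flipPairs-↭ β k)
  staircase-↭ : ∀ k → RowsArePerms (entry m α β) (staircase k)
  staircase-↭ zero    = ordinary zero ∷ []
  staircase-↭ (suc k) = ordinary (suc k) ∷ staircase-↭ k
  rows : ∀ ε → RowsArePerms (entry m α β) (shape ε m)
  rows false = staircase-↭ m
  rows true  = row-↭ _ _ _ (odd (suc m)) (flipPairs-↭ α (suc m)) (special-↭ m) (flipPairs-↭ β (suc m))
             ∷ staircase-↭ m

-- Column w (0-based) and entry w+1 both meet exactly
-- the rows of length > w; as the row lengths are the odd numbers up to 2·top+1, their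
-- number only depends on the pair of w+1.  This is what makes the pairs of columns and
-- of entries the only candidates for elementary transformations.

colCount-step : ∀ k w → ind (w <ᵇ odd k) + (k ∸ half (suc w)) ≡ suc k ∸ half (suc w)
colCount-step k w with w <? odd k
... | yes w<L rewrite <⇒<ᵇ≡true w<L = sym (+-∸-assoc 1 (≤odd⇒half≤ (suc w) k w<L))
... | no  w≮L rewrite ≥⇒<ᵇ≡false w (odd k) (≮⇒≥ w≮L) =
  trans (m≤n⇒m∸n≡0 (<⇒≤ k<h)) (sym (m≤n⇒m∸n≡0 k<h))
  where
  k<h : k < half (suc w)
  k<h = ≰⇒> (λ h≤k → w≮L (half≤⇒≤odd (suc w) k h≤k))

colCount-staircase : ∀ k w → colCount (staircase k) w ≡ suc k ∸ half (suc w)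
colCount-staircase zero    w = trans (cong (ind (w <ᵇ 1) +_) (sym (0∸n≡0 (half (suc w))))) (colCount-step zero w)
colCount-staircase (suc k) w =
  trans (cong (ind (w <ᵇ odd (suc k)) +_) (colCount-staircase k w)) (colCount-step (suc k) w)

colCount-shape : ∀ ε m w → colCount (shape ε m) w ≡ suc (top ε m) ∸ half (suc w)
colCount-shape false m w = colCount-staircase m w
colCount-shape true  m w = trans (cong (ind (w <ᵇ odd (suc m)) +_) (colCount-staircase m w)) (colCount-step (suc m) w)

colLen-tableau : ∀ ε m α β w → colLen (tableau ε m α β) w ≡ suc (top ε m) ∸ half (suc w)
colLen-tableau ε m α β w = trans (colLen-tab (entry m α β) (shape ε m) w) (colCount-shape ε m w)

occ-tableau-suc : ∀ ε m α β w → occ (tableau ε m α β) (suc w) ≡ suc (top ε m) ∸ half (suc w)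
occ-tableau-suc ε m α β w =
  trans (occ-tab-suc (entry m α β) (shape ε m) w (rows-↭ ε m α β)) (colCount-shape ε m w)

occ-tableau-0 : ∀ ε m α β → occ (tableau ε m α β) 0 ≡ 0
occ-tableau-0 ε m α β = occ-tab-0 (entry m α β) (shape ε m) (rows-↭ ε m α β)

lenAt-staircase : ∀ k i → i ≤ k → lenAt (staircase k) i ≡ odd (k ∸ i)
lenAt-staircase zero    zero    _       = refl
lenAt-staircase (suc k) zero    _       = refl
lenAt-staircase (suc k) (suc i) (s≤s p) = lenAt-staircase k i p

lenAt-shape : ∀ ε m i → i ≤ top ε m → lenAt (shape ε m) i ≡ odd (top ε m ∸ i)
lenAt-shape false m i       p       = lenAt-staircase m i p
lenAt-shape true  m zero    _       = refl
lenAt-shape true  m (suc i) (s≤s p) = lenAt-staircase m i p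

length-staircase : ∀ k → length (staircase k) ≡ suc k
length-staircase zero    = refl
length-staircase (suc k) = cong suc (length-staircase k)

length-tableau : ∀ ε m α β → length (tableau ε m α β) ≡ suc (top ε m)
length-tableau false m α β = trans (length-map _ (staircase m)) (length-staircase m)
length-tableau true  m α β = trans (length-map _ (shape true m)) (cong suc (length-staircase m))

rowLen-injective : ∀ ε m α β i j → i < length (tableau ε m α β) → j < length (tableau ε m α β) →
                   rowLen (tableau ε m α β) i ≡ rowLen (tableau ε m α β) j → i ≡ j
rowLen-injective ε m α β i j i<n j<n e = ∸-cancelˡ-≡ i≤top j≤top (odd-injective _ _ (begin
  odd (top ε m ∸ i)                ≡⟨ sym (lenAt-shape ε m i i≤top) ⟩
  lenAt (shape ε m) i              ≡⟨ sym (rowLen-tab (entry m α β) (shape ε m) i) ⟩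
  rowLen (tableau ε m α β) i       ≡⟨ e ⟩
  rowLen (tableau ε m α β) j       ≡⟨ rowLen-tab (entry m α β) (shape ε m) j ⟩
  lenAt (shape ε m) j              ≡⟨ lenAt-shape ε m j j≤top ⟩
  odd (top ε m ∸ j)                ∎))
  where
  open ≡-Reasoning
  i≤top : i ≤ top ε m
  i≤top = m<1+n⇒m≤n (subst (i <_) (length-tableau ε m α β) i<n)
  j≤top : j ≤ top ε m
  j≤top = m<1+n⇒m≤n (subst (j <_) (length-tableau ε m α β) j<n)

tableau-cong : ∀ ε m α α' β β' → (∀ j → α j ≡ α' j) → (∀ k → β k ≡ β' k) →
               tableau ε m α β ≡ tableau ε m α' β'
tableau-cong ε m α α' β β' pα pβ = tab-cong _ _ (shape ε m) (All.universal entries (shape ε m))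
  where
  entries : ∀ δ c → c < len δ → entry m α β δ c ≡ entry m α' β' δ c
  entries (E , L) c _ rewrite flipPairs-cong α α' (suc c) (λ j _ → pα j) =
    flipPairs-cong β β' (base m E L (flipPairs α' (suc c))) (λ k _ → pβ k)

odd-lengths : ∀ ε m → All (λ δ → ∃[ k ] len δ ≡ odd k) (shape ε m)
odd-lengths false m = staircase-odd m
  where
  staircase-odd : ∀ k → All (λ δ → ∃[ k ] len δ ≡ odd k) (staircase k)
  staircase-odd zero    = (zero , refl) ∷ []
  staircase-odd (suc k) = (suc k , refl) ∷ staircase-odd k
odd-lengths true  m = (suc m , refl) ∷ odd-lengths false m

column-swap-as-flip : ∀ u v j c → half (suc u) ≡ suc j → half (suc v) ≡ suc j → u ≢ v →
                      suc (swapℕ u v c) ≡ flipPairs (single j) (suc c)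
column-swap-as-flip u v j c hu hv u≢v =
  trans (swapℕ-suc u v c) (swapℕ-pair (suc u) (suc v) j (suc c) hu hv (u≢v ∘ suc-injective))

column-swap-in-row : ∀ u v j k c → half (suc u) ≡ suc j → half (suc v) ≡ suc j → u ≢ v →
                     c < odd k → swapℕ u v c < odd k
column-swap-in-row u v j k c hu hv u≢v c<L rewrite column-swap-as-flip u v j c hu hv u≢v =
  half≤⇒≤odd (flipPairs (single j) (suc c)) k
    (subst (_≤ k) (sym (half-flipPairs (single j) (suc c))) (≤odd⇒half≤ (suc c) k c<L))

column-swap : ∀ ε m α β u v j → half (suc u) ≡ suc j → half (suc v) ≡ suc j → u ≢ v →
              swapCols u v (tableau ε m α β) ≡ tableau ε m (α ⊕ single j) β
column-swap ε m α β u v j hu hv u≢v =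
  trans (swapCols-tab u v (entry m α β) (shape ε m) (All.map (λ {δ} → inRow {δ}) (odd-lengths ε m)))
        (tab-cong _ _ (shape ε m) (All.universal entries (shape ε m)))
  where
  inRow : ∀ {δ} → ∃[ k ] len δ ≡ odd k → ∀ c → c < len δ → swapℕ u v c < len δ
  inRow (k , e) c rewrite e = column-swap-in-row u v j k c hu hv u≢v
  entries : ∀ δ c → c < len δ → entry m α β δ (swapℕ u v c) ≡ entry m (α ⊕ single j) β δ c
  entries (E , L) c _ = cong (λ C → flipPairs β (base m E L C))
    (trans (cong (flipPairs α) (column-swap-as-flip u v j c hu hv u≢v)) (flipPairs-∘ α (single j) (suc c)))

entry-swap : ∀ ε m α β x y k → half x ≡ suc k → half y ≡ suc k → x ≢ y →
             swapEntries x y (tableau ε m α β) ≡ tableau ε m α (single k ⊕ β)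
entry-swap ε m α β x y k hx hy x≢y =
  trans (swapEntries-tab x y (entry m α β) (shape ε m))
        (tab-cong _ _ (shape ε m) (All.universal entries (shape ε m)))
  where
  entries : ∀ δ c → c < len δ → swapℕ x y (entry m α β δ c) ≡ entry m α (single k ⊕ β) δ c
  entries (E , L) c _ rewrite swapℕ-pair x y k (entry m α β (E , L) c) hx hy x≢y =
    flipPairs-∘ (single k) β (base m E L (flipPairs α (suc c)))

swapEntries-absent : ∀ x y T → occ T x ≡ 0 → occ T y ≡ 0 → swapEntries x y T ≡ T
swapEntries-absent x y []      _  _  = refl
swapEntries-absent x y (r ∷ T) ox oy =
  cong₂ _∷_ (row-absent r (m+n≡0⇒m≡0 _ ox′) (m+n≡0⇒m≡0 _ oy′))
            (swapEntries-absent x y T (m+n≡0⇒n≡0 (count x r) ox′) (m+n≡0⇒n≡0 (count y r) oy′))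
  where
  ox′ : count x r + occ T x ≡ 0
  ox′ = trans (sym (occ-∷ r T x)) ox
  oy′ : count y r + occ T y ≡ 0
  oy′ = trans (sym (occ-∷ r T y)) oy
  row-absent : ∀ r → count x r ≡ 0 → count y r ≡ 0 → map (swapℕ x y) r ≡ r
  row-absent []      _  _  = refl
  row-absent (z ∷ r) cx cy with x ≡ᵇ z in ex | y ≡ᵇ z in ey
  ... | false | false = cong₂ _∷_ (swapℕ-fixes x y z (differs ex) (differs ey)) (row-absent r cx cy)
    where
    differs : ∀ {v} → (v ≡ᵇ z) ≡ false → z ≢ v
    differs {v} e refl with trans (sym e) (≡ᵇ-refl v)
    ... | ()

-- In the tableaux with a special row, the two 1-based columns 2m+2, 2m+3 have length 1,
-- and exchanging them has the same effect as interchanging the entries 2m+2, 2m+3.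

half-suc-≤ : ∀ n → half (suc n) ≤ suc (half n)
half-suc-≤ zero          = z≤n
half-suc-≤ (suc zero)    = ≤-refl
half-suc-≤ (suc (suc n)) = s≤s (half-suc-≤ n)

special-fixes-high : ∀ m C → suc m ≤ half C → special m C ≡ C
special-fixes-high m (suc C) p = special-fixes m (suc C) (m<1+n⇒m≤n (≤-trans p (half-suc-≤ C)))

special-half : ∀ m C → half C ≤ m → half (special m C) ≤ m
special-half m C p with half (pred C) <ᵇ m in e
... | false = p
... | true  = ≤-trans (half-suc-≤ (partner (pred C)))
                (subst (λ h → suc h ≤ m) (sym (half-partner (pred C))) (<ᵇ≡true⇒< _ _ e))

flipPairs-pos : ∀ β n → 1 ≤ n → 1 ≤ flipPairs β n
flipPairs-pos β (suc zero)    _ = ≤-refl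
flipPairs-pos β (suc (suc n)) _ with pairBit β (half (suc (suc n)))
... | true  = s≤s z≤n
... | false = s≤s z≤n

flipPairs-agree : ∀ β γ m n → (∀ j → j < m → β j ≡ γ j) → half n ≤ m → flipPairs β n ≡ flipPairs γ n
flipPairs-agree β γ m n p h = flipPairs-cong β γ n (λ j e → p j (subst (_≤ m) (sym e) h))

single-below : ∀ m j → j < m → single m j ≡ false
single-below m j j<m = ≢⇒≡ᵇ≡false j m (<⇒≢ j<m)

flipIf-partner : ∀ b n → flipIf b (partner n) ≡ flipIf (not b) n
flipIf-partner true  n = partner-involutive n
flipIf-partner false n = refl

-- The coincidence itself: both sides agree on the rows where only the first m+1
-- pairs of columns and entries occur, and on the last two columns of the special row.
column-entry-coincidence : ∀ m α β → α m ≡ false →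
                           tableau true m (α ⊕ single m) β ≡ tableau true m α (single m ⊕ β)
column-entry-coincidence m α β αm≡false =
  tab-cong _ _ (shape true m) (specialRow ∷ ordinaryRows m ≤-refl)
  where
  α′ β′ : ℕ → Bool
  α′ = α ⊕ single m
  β′ = single m ⊕ β
  lowα : ∀ n → half n ≤ m → flipPairs α′ n ≡ flipPairs α n
  lowα n = flipPairs-agree α′ α m n
    (λ j j<m → trans (cong (α j xor_) (single-below m j j<m)) (xor-identityʳ (α j)))
  lowβ : ∀ n → half n ≤ m → flipPairs β n ≡ flipPairs β′ n
  lowβ n = flipPairs-agree β β′ m n (λ j j<m → cong (_xor β j) (sym (single-below m j j<m)))
  ordinary : ∀ k → k ≤ m → ∀ c → c < odd k → entry m α′ β (false , odd k) c ≡ entry m α β′ (false , odd k) c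
  ordinary k k≤m c c<L rewrite lowα (suc c) (≤-trans (≤odd⇒half≤ (suc c) k c<L) k≤m) =
    lowβ _ (≤-trans (≤odd⇒half≤ _ k (∸-monoʳ-≤ (suc (odd k)) (flipPairs-pos α (suc c) (s≤s z≤n)))) k≤m)
  ordinaryRows : ∀ k → k ≤ m →
                 All (λ δ → ∀ c → c < len δ → entry m α′ β δ c ≡ entry m α β′ δ c) (staircase k)
  ordinaryRows zero    k≤m = ordinary zero k≤m ∷ []
  ordinaryRows (suc k) k≤m = ordinary (suc k) k≤m ∷ ordinaryRows k (≤-trans (n≤1+n k) k≤m)
  -- in the special row only the last two columns reach pair m+1
  specialRow : ∀ c → c < odd (suc m) →
               entry m α′ β (true , odd (suc m)) c ≡ entry m α β′ (true , odd (suc m)) c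
  specialRow c c<L with half (suc c) ≤? m
  ... | yes low rewrite lowα (suc c) low =
    lowβ _ (special-half m _ (subst (_≤ m) (sym (half-flipPairs α (suc c))) low))
  ... | no ¬low = high
    where
    hc : half (suc c) ≡ suc m
    hc = ≤-antisym (≤odd⇒half≤ (suc c) (suc m) c<L) (≰⇒> ¬low)
    high : flipPairs β (special m (flipPairs α′ (suc c))) ≡ flipPairs β′ (special m (flipPairs α (suc c)))
    high rewrite hc | αm≡false | ≡ᵇ-refl m
               | special-fixes-high m (partner (suc c)) (≤-reflexive (sym (trans (half-partner (suc c)) hc)))
               | special-fixes-high m (suc c) (≤-reflexive (sym hc))
               | half-partner (suc c) | hc | ≡ᵇ-refl m = flipIf-partner (β m) (suc c)

-- Vertices of the cube.  A point x of {0,1}^(m + top ε m) gives the column bits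
-- x₀ … x_{m-1} and the entry bits x_m … ; flipping one coordinate toggles one bit.

dim : Bool → ℕ → ℕ
dim ε m = m + top ε m

bit : ∀ {n} → Vec Bool n → ℕ → Bool
bit []      _       = false
bit (b ∷ x) zero    = b
bit (b ∷ x) (suc i) = bit x i

flipBit : ∀ {n} → Vec Bool n → Fin n → Vec Bool n
flipBit x t = updateAt x t not

bit-flipBit : ∀ {n} (x : Vec Bool n) t i → bit (flipBit x t) i ≡ bit x i xor single (toℕ t) i
bit-flipBit (b ∷ x) Fin.zero    zero    = sym (xor-comm b true)
bit-flipBit (b ∷ x) Fin.zero    (suc i) = sym (xor-identityʳ (bit x i))
bit-flipBit (b ∷ x) (Fin.suc t) zero    = sym (xor-identityʳ b)
bit-flipBit (b ∷ x) (Fin.suc t) (suc i) = bit-flipBit x t i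

bit-ext : ∀ {n} (x y : Vec Bool n) → (∀ i → i < n → bit x i ≡ bit y i) → x ≡ y
bit-ext []      []      _ = refl
bit-ext (b ∷ x) (c ∷ y) p = cong₂ _∷_ (p 0 (s≤s z≤n)) (bit-ext x y (λ i i<n → p (suc i) (s≤s i<n)))

colBits : ∀ {n} → ℕ → Vec Bool n → ℕ → Bool
colBits m x j = (j <ᵇ m) ∧ bit x j

entBits : ∀ {n} → ℕ → Vec Bool n → ℕ → Bool
entBits m x k = bit x (m + k)

vertex : ∀ ε m → Vec Bool (dim ε m) → Tableau
vertex ε m x = tableau ε m (colBits m x) (entBits m x)

colCoord : ∀ ε m j → j < m → Fin (dim ε m)
colCoord ε m j j<m = fromℕ< (<-≤-trans j<m (m≤m+n m (top ε m)))

entCoord : ∀ ε m k → k < top ε m → Fin (dim ε m)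
entCoord ε m k k<top = fromℕ< (+-monoʳ-< m k<top)

vertex-flip-col : ∀ ε m x j (j<m : j < m) →
                  vertex ε m (flipBit x (colCoord ε m j j<m)) ≡ tableau ε m (colBits m x ⊕ single j) (entBits m x)
vertex-flip-col ε m x j j<m = tableau-cong ε m _ _ _ _ colEq entEq
  where
  t : Fin (dim ε m)
  t = colCoord ε m j j<m
  t≡j : toℕ t ≡ j
  t≡j = toℕ-fromℕ< (<-≤-trans j<m (m≤m+n m (top ε m)))
  colEq : ∀ i → colBits m (flipBit x t) i ≡ (colBits m x ⊕ single j) i
  colEq i rewrite bit-flipBit x t i | t≡j with i <ᵇ m in e
  ... | true  = refl
  ... | false = sym (single-below' (<ᵇ≡false⇒≥ i m e))
    where
    single-below' : m ≤ i → single j i ≡ false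
    single-below' m≤i = ≢⇒≡ᵇ≡false i j (λ i≡j → <⇒≢ (<-≤-trans j<m m≤i) (sym i≡j))
  entEq : ∀ k → entBits m (flipBit x t) k ≡ entBits m x k
  entEq k rewrite bit-flipBit x t (m + k) | t≡j
                | ≢⇒≡ᵇ≡false (m + k) j (λ e → <⇒≢ (<-≤-trans j<m (m≤m+n m k)) (sym e)) = xor-identityʳ _

≡ᵇ-+ : ∀ m i k → (m + i ≡ᵇ m + k) ≡ (i ≡ᵇ k)
≡ᵇ-+ zero    i k = refl
≡ᵇ-+ (suc m) i k = ≡ᵇ-+ m i k

vertex-flip-ent : ∀ ε m x k (k<top : k < top ε m) →
                  vertex ε m (flipBit x (entCoord ε m k k<top))
                  ≡ tableau ε m (colBits m x) (single k ⊕ entBits m x)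
vertex-flip-ent ε m x k k<top = tableau-cong ε m _ _ _ _ colEq entEq
  where
  t : Fin (dim ε m)
  t = entCoord ε m k k<top
  t≡m+k : toℕ t ≡ m + k
  t≡m+k = toℕ-fromℕ< (+-monoʳ-< m k<top)
  colEq : ∀ i → colBits m (flipBit x t) i ≡ colBits m x i
  colEq i rewrite bit-flipBit x t i | t≡m+k with i <ᵇ m in e
  ... | true rewrite ≢⇒≡ᵇ≡false i (m + k) (<⇒≢ (<-≤-trans (<ᵇ≡true⇒< i m e) (m≤m+n m k))) = xor-identityʳ _
  ... | false = refl
  entEq : ∀ i → entBits m (flipBit x t) i ≡ (single k ⊕ entBits m x) i
  entEq i rewrite bit-flipBit x t (m + i) | t≡m+k | ≡ᵇ-+ m i k = xor-comm (bit x (m + i)) (i ≡ᵇ k)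

half-suc≡0 : ∀ u → half (suc u) ≡ 0 → u ≡ 0
half-suc≡0 zero _ = refl

common-pair : ∀ K u v → u ≢ v → K ∸ half (suc u) ≢ 0 → K ∸ half (suc u) ≡ K ∸ half (suc v) →
              ∃[ j ] (half (suc u) ≡ suc j × half (suc v) ≡ suc j × suc j < K)
common-pair K u v u≢v nz e = inPair (half (suc u)) refl
  where
  hu<K : half (suc u) < K
  hu<K = m∸n≢0⇒n<m nz
  hu≡hv : half (suc u) ≡ half (suc v)
  hu≡hv = ∸-cancelˡ-≡ (<⇒≤ hu<K) (<⇒≤ (m∸n≢0⇒n<m (λ z → nz (trans e z)))) e
  inPair : ∀ h → half (suc u) ≡ h → ∃[ j ] (half (suc u) ≡ suc j × half (suc v) ≡ suc j × suc j < K)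
  inPair zero    hu = ⊥-elim (u≢v (trans (half-suc≡0 u hu) (sym (half-suc≡0 v (trans (sym hu≡hv) hu)))))
  inPair (suc j) hu = j , hu , trans (sym hu≡hv) hu , subst (_< K) hu hu<K

-- The column pairs j < top ε m are exactly the coordinates of the cube, except that
-- with a special row the column pair m is the entry coordinate m.
column-pair-move : ∀ ε m (x : Vec Bool (dim ε m)) j → j < top ε m →
                   ∃[ t ] tableau ε m (colBits m x ⊕ single j) (entBits m x) ≡ vertex ε m (flipBit x t)
column-pair-move ε m x j j<top with j <? m
column-pair-move ε     m x j j<top | yes j<m = colCoord ε m j j<m , sym (vertex-flip-col ε m x j j<m)
column-pair-move false m x j j<m   | no  j≮m = ⊥-elim (j≮m j<m)
column-pair-move true  m x j j<1+m | no  j≮m with ≤-antisym (m<1+n⇒m≤n j<1+m) (≮⇒≥ j≮m)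
... | refl = entCoord true m m ≤-refl ,
  trans (column-entry-coincidence m (colBits m x) (entBits m x) (cong (_∧ bit x m) (≥⇒<ᵇ≡false m m ≤-refl)))
        (sym (vertex-flip-ent true m x m ≤-refl))

-- Classification of the elementary transformations of a vertex: row swaps are trivial
-- (distinct row lengths), column and entry swaps are trivial or exchange one pair.
vertex-moves : ∀ ε m (x : Vec Bool (dim ε m)) S → Elementary (vertex ε m x) S →
               S ≡ vertex ε m x ⊎ ∃[ t ] S ≡ vertex ε m (flipBit x t)
vertex-moves ε m x S (rowSwap i j i<n j<n e)
  rewrite rowLen-injective ε m (colBits m x) (entBits m x) i j i<n j<n e = inj₁ (swapRows-same j _)
vertex-moves ε m x S (colSwap u v lu lv e) with u ≟ v
... | yes refl = inj₁ (swapCols-same u _)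
... | no  u≢v with common-pair (suc (top ε m)) u v u≢v
                     (λ z → n>0⇒n≢0 lu (trans (colLen-tableau ε m (colBits m x) (entBits m x) u) z))
                     (trans (sym (colLen-tableau ε m (colBits m x) (entBits m x) u))
                            (trans e (colLen-tableau ε m (colBits m x) (entBits m x) v)))
...   | j , hu , hv , s≤s j<top with column-pair-move ε m x j j<top
...     | t , moved = inj₂ (t , trans (column-swap ε m (colBits m x) (entBits m x) u v j hu hv u≢v) moved)
vertex-moves ε m x S (entrySwap y z e) with occ (vertex ε m x) y ≟ 0
... | yes absent = inj₁ (swapEntries-absent y z _ absent (trans (sym e) absent))
... | no  present with y ≟ z
...   | yes refl = inj₁ (swapEntries-same y _)
...   | no  y≢z = inj₂ (moved y z e present y≢z)
  where
  moved : ∀ y z → occ (vertex ε m x) y ≡ occ (vertex ε m x) z → occ (vertex ε m x) y ≢ 0 → y ≢ z →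
          ∃[ t ] swapEntries y z (vertex ε m x) ≡ vertex ε m (flipBit x t)
  moved zero    z       e present _ = ⊥-elim (present (occ-tableau-0 ε m (colBits m x) (entBits m x)))
  moved (suc w) zero    e present _ = ⊥-elim (present (trans e (occ-tableau-0 ε m (colBits m x) (entBits m x))))
  moved (suc w) (suc w′) e present w≢w′
    with common-pair (suc (top ε m)) w w′ (w≢w′ ∘ cong suc)
           (λ z → present (trans (occ-tableau-suc ε m (colBits m x) (entBits m x) w) z))
           (trans (sym (occ-tableau-suc ε m (colBits m x) (entBits m x) w))
                  (trans e (occ-tableau-suc ε m (colBits m x) (entBits m x) w′)))
  ... | k , hy , hz , s≤s k<top =
    entCoord ε m k k<top ,
    trans (entry-swap ε m (colBits m x) (entBits m x) (suc w) (suc w′) k hy hz w≢w′)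
          (sym (vertex-flip-ent ε m x k k<top))

top-≥ : ∀ ε m → m ≤ top ε m
top-≥ false m = ≤-refl
top-≥ true  m = n≤1+n m

column-flip-move : ∀ ε m (x : Vec Bool (dim ε m)) j (j<m : j < m) →
                   Elementary (vertex ε m x) (vertex ε m (flipBit x (colCoord ε m j j<m)))
column-flip-move ε m x j j<m =
  subst (Elementary (vertex ε m x)) swapped
    (colSwap u v (len≥1 u hu) (len≥1 v hv) (trans (lenEq u hu) (sym (lenEq v hv))))
  where
  u v : ℕ
  u = odd j
  v = dbl (suc j)
  hu : half (suc u) ≡ suc j
  hu = half-dbl (suc j)
  hv : half (suc v) ≡ suc j
  hv = half-odd (suc j)
  lenEq : ∀ w → half (suc w) ≡ suc j → colLen (vertex ε m x) w ≡ suc (top ε m) ∸ suc j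
  lenEq w h = trans (colLen-tableau ε m (colBits m x) (entBits m x) w) (cong (suc (top ε m) ∸_) h)
  len≥1 : ∀ w → half (suc w) ≡ suc j → 1 ≤ colLen (vertex ε m x) w
  len≥1 w h = subst (1 ≤_) (sym (lenEq w h)) (m<n⇒0<n∸m (s≤s (<-≤-trans j<m (top-≥ ε m))))
  swapped : swapCols u v (vertex ε m x) ≡ vertex ε m (flipBit x (colCoord ε m j j<m))
  swapped = trans (column-swap ε m _ _ u v j hu hv (1+n≢n ∘ sym)) (sym (vertex-flip-col ε m x j j<m))

entry-flip-move : ∀ ε m (x : Vec Bool (dim ε m)) k (k<top : k < top ε m) →
                  Elementary (vertex ε m x) (vertex ε m (flipBit x (entCoord ε m k k<top)))
entry-flip-move ε m x k k<top =
  subst (Elementary (vertex ε m x)) swapped (entrySwap y z (trans (occEq y hy) (sym (occEq z hz))))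
  where
  y z : ℕ
  y = dbl (suc k)
  z = odd (suc k)
  hy : half y ≡ suc k
  hy = half-dbl (suc k)
  hz : half z ≡ suc k
  hz = half-odd (suc k)
  occEq : ∀ w → half w ≡ suc k → occ (vertex ε m x) w ≡ suc (top ε m) ∸ suc k
  occEq (suc w) h = trans (occ-tableau-suc ε m (colBits m x) (entBits m x) w) (cong (suc (top ε m) ∸_) h)
  swapped : swapEntries y z (vertex ε m x) ≡ vertex ε m (flipBit x (entCoord ε m k k<top))
  swapped = trans (entry-swap ε m _ _ y z k hy hz (1+n≢n ∘ sym)) (sym (vertex-flip-ent ε m x k k<top))

coordinate-kinds : ∀ ε m (t : Fin (dim ε m)) → (∃[ j ] ∃[ j<m ] colCoord ε m j j<m ≡ t)
                                              ⊎ (∃[ k ] ∃[ k<top ] entCoord ε m k k<top ≡ t)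
coordinate-kinds ε m t with toℕ t <? m
... | yes j<m = inj₁ (toℕ t , j<m , fromℕ<-toℕ t _)
... | no  j≮m =
  inj₂ (toℕ t ∸ m , k<top , trans (fromℕ<-cong _ _ m+k≡t _ (toℕ<n t)) (fromℕ<-toℕ t (toℕ<n t)))
  where
  m+k≡t : m + (toℕ t ∸ m) ≡ toℕ t
  m+k≡t = m+[n∸m]≡n (≮⇒≥ j≮m)
  k<top : toℕ t ∸ m < top ε m
  k<top = +-cancelˡ-< m (toℕ t ∸ m) (top ε m) (subst (_< dim ε m) (sym m+k≡t) (toℕ<n t))

vertex-flip-move : ∀ ε m (x : Vec Bool (dim ε m)) t → Elementary (vertex ε m x) (vertex ε m (flipBit x t))
vertex-flip-move ε m x t with coordinate-kinds ε m t
... | inj₁ (j , j<m , refl)   = column-flip-move ε m x j j<m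
... | inj₂ (k , k<top , refl) = entry-flip-move ε m x k k<top

-- Distinct points give distinct vertices: the bits can be read off the tableau.

Agree : ℕ → (ℕ → Bool) → (ℕ → Bool) → Set
Agree n β γ = ∀ j → j < n → β j ≡ γ j

Agree-suc : ∀ {n β γ} → Agree n β γ → β n ≡ γ n → Agree (suc n) β γ
Agree-suc {n} p q j j<1+n with j <? n
... | yes j<n = p j j<n
... | no  j≮n rewrite ≤-antisym (m<1+n⇒m≤n j<1+n) (≮⇒≥ j≮n) = q

applyUpTo-injective-at : ∀ (g g′ : ℕ → ℕ) L c → applyUpTo g L ≡ applyUpTo g′ L → c < L → g c ≡ g′ c
applyUpTo-injective-at g g′ L c e c<L =
  just-injective (trans (sym (nth-applyUpTo-< g L c c<L))
                        (trans (cong (λ r → nth r c) e) (nth-applyUpTo-< g′ L c c<L)))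

-- In an ordinary row of length 2k+1 whose entry bits below k are known, the entry in
-- 0-based column 2j+1 (j < k) determines the column bit j.
decode-column-bit : ∀ m α β α′ β′ k → Agree k β β′ →
                    applyUpTo (entry m α β (false , odd k)) (odd k)
                    ≡ applyUpTo (entry m α′ β′ (false , odd k)) (odd k) →
                    Agree k α α′
decode-column-bit m α β α′ β′ k β≈β′ e j j<k =
  flipIf-injective (α j) (α′ j) (dbl (suc j)) (trans (sym (flipPairs-dbl α j)) (trans C≡C′ (flipPairs-dbl α′ j)))
  where
  L C C′ : ℕ
  L  = odd k
  C  = flipPairs α (dbl (suc j))
  C′ = flipPairs α′ (dbl (suc j))
  C≤L : ∀ γ → flipPairs γ (dbl (suc j)) ≤ L
  C≤L γ = half≤⇒≤odd _ k (subst (_≤ k) (sym (trans (half-flipPairs γ _) (half-dbl (suc j)))) j<k)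
  C≥1 : ∀ γ → 1 ≤ flipPairs γ (dbl (suc j))
  C≥1 γ = flipPairs-pos γ (dbl (suc j)) (s≤s z≤n)
  same-entry : flipPairs β (suc L ∸ C) ≡ flipPairs β′ (suc L ∸ C′)
  same-entry = applyUpTo-injective-at (entry m α β (false , L)) (entry m α′ β′ (false , L)) L (odd j) e
                 (s≤s (≤-trans (n≤1+n _) (dbl-mono j<k)))
  value-low : half (suc L ∸ C′) ≤ k
  value-low = ≤odd⇒half≤ _ k (∸-monoʳ-≤ (suc L) (C≥1 α′))
  C≡C′ : C ≡ C′
  C≡C′ = ∸-cancelˡ-≡ (m≤n⇒m≤1+n (C≤L α)) (m≤n⇒m≤1+n (C≤L α′))
           (flipPairs-injective β _ _ (trans same-entry (sym (flipPairs-agree β β′ k _ β≈β′ value-low))))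

-- The first entry of the ordinary row of length 2k+3 is flipPairs β (2k+3), which
-- determines the entry bit k; then the column bits follow row by row.
decode-staircase : ∀ m α β α′ β′ k → tab (entry m α β) (staircase k) ≡ tab (entry m α′ β′) (staircase k) →
                   Agree k β β′ × Agree k α α′
decode-staircase m α β α′ β′ zero    e = (λ _ ()) , (λ _ ())
decode-staircase m α β α′ β′ (suc k) e with ∷-injective e
... | top≡ , rest≡ = β≈β′ , decode-column-bit m α β α′ β′ (suc k) β≈β′ top≡
  where
  L : ℕ
  L = odd (suc k)
  first-entry : flipPairs β L ≡ flipPairs β′ L
  first-entry =
    applyUpTo-injective-at (entry m α β (false , L)) (entry m α′ β′ (false , L)) L 0 top≡ (s≤s z≤n)
  β≈β′ : Agree (suc k) β β′
  β≈β′ = Agree-suc (proj₁ (decode-staircase m α β α′ β′ k rest≡))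
           (flipIf-injective (β k) (β′ k) L
             (trans (sym (flipPairs-odd β k)) (trans first-entry (flipPairs-odd β′ k))))

-- With a special row, its entry in 0-based column 2m+1 is flipPairs β (2m+2) as long as
-- the column bit m is off; it determines the entry bit m.
decode-tableau : ∀ ε m α β α′ β′ → α m ≡ false → α′ m ≡ false → tableau ε m α β ≡ tableau ε m α′ β′ →
                 Agree (top ε m) β β′ × Agree m α α′
decode-tableau false m α β α′ β′ _   _    e = decode-staircase m α β α′ β′ m e
decode-tableau true  m α β α′ β′ αm αm′ e with ∷-injective e
... | top≡ , rest≡ with decode-staircase m α β α′ β′ m rest≡
... | β≈β′ , α≈α′ = Agree-suc β≈β′ βm≡β′m , α≈α′
  where
  L : ℕ
  L = odd (suc m)
  special-entry : ∀ α β → α m ≡ false → entry m α β (true , L) (odd m) ≡ flipIf (β m) (dbl (suc m))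
  special-entry α β αm rewrite flipPairs-dbl α m | αm
    | special-fixes-high m (dbl (suc m)) (≤-reflexive (sym (half-dbl (suc m)))) = flipPairs-dbl β m
  βm≡β′m : β m ≡ β′ m
  βm≡β′m = flipIf-injective (β m) (β′ m) (dbl (suc m)) (begin
    flipIf (β m) (dbl (suc m))              ≡⟨ sym (special-entry α β αm) ⟩
    entry m α β (true , L) (odd m)
      ≡⟨ applyUpTo-injective-at (entry m α β (true , L)) (entry m α′ β′ (true , L)) L (odd m) top≡ (s≤s (n≤1+n _)) ⟩
    entry m α′ β′ (true , L) (odd m)        ≡⟨ special-entry α′ β′ αm′ ⟩
    flipIf (β′ m) (dbl (suc m))             ∎)
    where open ≡-Reasoning

colBits-m : ∀ {n} m (x : Vec Bool n) → colBits m x m ≡ false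
colBits-m m x rewrite ≥⇒<ᵇ≡false m m ≤-refl = refl

-- The column bits are truncated at m, so the entry bit m can be read off even with a special row.
vertex-injective : ∀ ε m (x y : Vec Bool (dim ε m)) → vertex ε m x ≡ vertex ε m y → x ≡ y
vertex-injective ε m x y e with decode-tableau ε m _ _ _ _ (colBits-m m x) (colBits-m m y) e
... | ent≈ , col≈ = bit-ext x y same-bit
  where
  same-bit : ∀ i → i < dim ε m → bit x i ≡ bit y i
  same-bit i i<d with i <? m
  ... | yes i<m = subst (λ b → b ∧ bit x i ≡ b ∧ bit y i) (<⇒<ᵇ≡true i<m) (col≈ i i<m)
  ... | no  i≮m = subst (λ n → bit x n ≡ bit y n) m+k≡i (ent≈ (i ∸ m) k<top)
    where
    m+k≡i : m + (i ∸ m) ≡ i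
    m+k≡i = m+[n∸m]≡n (≮⇒≥ i≮m)
    k<top : i ∸ m < top ε m
    k<top = +-cancelˡ-< m (i ∸ m) (top ε m) (subst (_< dim ε m) (sym m+k≡i) i<d)

base-ordinary : ∀ m L c → entry m zeros zeros (false , L) c ≡ L ∸ c
base-ordinary m L c rewrite flipPairs-zeros (suc c) = flipPairs-zeros (L ∸ c)

base-special : ∀ m L c → entry m zeros zeros (true , L) c ≡ special m (suc c)
base-special m L c rewrite flipPairs-zeros (suc c) = flipPairs-zeros (special m (suc c))

-- In column c, the ordinary row of length 2k′+1 holds 2k′+1-c: entry and column
-- index add up to an odd number, which identifies the row.
OrdinaryValue : ℕ → ℕ → ℕ → Set
OrdinaryValue k c v = ∃[ k′ ] (k′ ≤ k × v + c ≡ odd k′)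

staircase-column : ∀ m k c → Unique (colList (entry m zeros zeros) (staircase k) c)
                             × All (OrdinaryValue k c) (colList (entry m zeros zeros) (staircase k) c)
staircase-column m k c = go k
  where
  value : ∀ k → c < odd k → entry m zeros zeros (false , odd k) c + c ≡ odd k
  value k c<L rewrite base-ordinary m (odd k) c = m∸n+n≡m (<⇒≤ c<L)
  weaken : ∀ {k} → All (OrdinaryValue k c) ⊆ All (OrdinaryValue (suc k) c)
  weaken = All.map (λ { (k′ , k′≤k , e) → k′ , ≤-trans k′≤k (n≤1+n _) , e })
  go : ∀ k → Unique (colList (entry m zeros zeros) (staircase k) c)
             × All (OrdinaryValue k c) (colList (entry m zeros zeros) (staircase k) c)
  go zero with c <ᵇ 1 in c<1
  ... | true  = [] ∷ [] , (0 , z≤n , value 0 (<ᵇ≡true⇒< c 1 c<1)) ∷ []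
  ... | false = [] , []
  go (suc k) with go k | c <ᵇ odd (suc k) in c<L
  ... | unique , values | true  =
    All.map new values ∷ unique , (suc k , ≤-refl , value (suc k) c<L′) ∷ weaken values
    where
    c<L′ : c < odd (suc k)
    c<L′ = <ᵇ≡true⇒< c _ c<L
    new : ∀ {v} → OrdinaryValue k c v → entry m zeros zeros (false , odd (suc k)) c ≢ v
    new (k′ , k′≤k , e) refl =
      1+n≰n (subst (_≤ k) (odd-injective k′ (suc k) (trans (sym e) (value (suc k) c<L′))) k′≤k)
  ... | unique , values | false = unique , weaken values

partner-+-self : ∀ c → ∃[ h ] partner c + c ≡ odd h
partner-+-self zero          = 0 , refl
partner-+-self (suc zero)    = 0 , refl
partner-+-self (suc (suc c)) with partner-+-self c
... | h , e = suc (suc h) ,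
  cong (suc ∘ suc) (trans (+-suc (partner c) (suc c)) (cong suc (trans (+-suc (partner c) c) (cong suc e))))

odd≢dbl : ∀ h k → odd h ≢ dbl k
odd≢dbl zero    (suc zero)    ()
odd≢dbl (suc h) (suc (suc k)) e = odd≢dbl h (suc k) (suc-injective (suc-injective e))
odd≢dbl (suc h) (suc zero) ()

+-self : ∀ c → c + c ≡ dbl c
+-self zero    = refl
+-self (suc c) = cong suc (trans (+-suc c c) (cong suc (+-self c)))

half-< : ∀ c → 1 ≤ c → half c < c
half-< (suc zero)          _ = s≤s z≤n
half-< (suc (suc zero))    _ = s≤s (s≤s z≤n)
half-< (suc (suc (suc c))) _ = s≤s (≤-trans (half-< (suc c) (s≤s z≤n)) (n≤1+n _))

-- For m ≥ 1 the special row differs from every ordinary row in every column: in its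
-- first 2m columns entry and column index add up to an even number, and beyond them
-- the column is too long for an ordinary row.
special-not-ordinary : ∀ m′ c v → OrdinaryValue (suc m′) c v → special (suc m′) (suc c) ≢ v
special-not-ordinary m′ c v (k′ , k′≤ , e) with half c <ᵇ suc m′ in lowPair
... | true  = λ s≡v → let (h , e′) = partner-+-self c in
                odd≢dbl h k′ (trans (sym e′) (suc-injective (trans (cong (_+ c) s≡v) e)))
... | false = λ s≡v →
  1+n≰n (≤-trans (s≤s high) (≤-trans (half-< c (positive c high)) (subst (_≤ suc m′) (sym (c≡k′ s≡v)) k′≤)))
  where
  high : suc m′ ≤ half c
  high = <ᵇ≡false⇒≥ (half c) (suc m′) lowPair
  positive : ∀ c → suc m′ ≤ half c → 1 ≤ c
  positive (suc c) _ = s≤s z≤n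
  c≡k′ : suc c ≡ v → c ≡ k′
  c≡k′ s≡v = dbl-injective c k′ (trans (sym (+-self c)) (suc-injective (trans (cong (_+ c) s≡v) e)))

odd-≤-suc : ∀ k → odd k ≤ odd (suc k)
odd-≤-suc k = ≤-trans (n≤1+n (odd k)) (n≤1+n (suc (odd k)))

shape-decreasing : ∀ ε m → Linked _≥_ (map len (shape ε m))
shape-decreasing false m = staircase-decreasing m
  where
  staircase-decreasing : ∀ k → Linked _≥_ (map len (staircase k))
  staircase-decreasing zero          = [-]
  staircase-decreasing (suc zero)    = odd-≤-suc 0 ∷ [-]
  staircase-decreasing (suc (suc k)) = odd-≤-suc (suc k) ∷ staircase-decreasing (suc k)
shape-decreasing true  zero    = odd-≤-suc 0 ∷ [-]
shape-decreasing true  (suc m) = odd-≤-suc (suc m) ∷ shape-decreasing false (suc m)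

base-latin : ∀ ε m → LatinTableau (tableau ε (suc m) zeros zeros)
base-latin ε m = shape-ok , rows-ok , columns-ok ε
  where
  G : RowSpec → ℕ → ℕ
  G = entry (suc m) zeros zeros
  shape-ok : IsPartitionShape (tableau ε (suc m) zeros zeros)
  shape-ok = All-tab G (shape ε (suc m)) (λ {δ} → nonempty {δ}) (odd-lengths ε (suc m))
           , subst (Linked _≥_) (sym (map-length-tab G (shape ε (suc m)))) (shape-decreasing ε (suc m))
    where
    nonempty : ∀ {δ} → ∃[ k ] len δ ≡ odd k → 1 ≤ length (applyUpTo (G δ) (len δ))
    nonempty {δ} (k , e) rewrite length-applyUpTo (G δ) (len δ) | e = s≤s z≤n
  rows-ok : All (λ r → r ↭ range1 (length r)) (tableau ε (suc m) zeros zeros)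
  rows-ok = All-tab G (shape ε (suc m)) (λ {δ} → withLength {δ}) (rows-↭ ε (suc m) zeros zeros)
    where
    withLength : ∀ {δ} → applyUpTo (G δ) (len δ) ↭ range1 (len δ) →
                 applyUpTo (G δ) (len δ) ↭ range1 (length (applyUpTo (G δ) (len δ)))
    withLength {δ} p rewrite length-applyUpTo (G δ) (len δ) = p
  columns-ok : ∀ ε c → Unique (column (tableau ε (suc m) zeros zeros) c)
  columns-ok false c rewrite column-tab G (shape false (suc m)) c = proj₁ (staircase-column (suc m) (suc m) c)
  columns-ok true  c rewrite column-tab G (shape true (suc m)) c with staircase-column (suc m) (suc m) c
  ... | unique , values with c <ᵇ odd (suc (suc m))
  ...   | true  = All.map (λ {v} o s≡v → special-not-ordinary m c v o (trans (sym (base-special′ c)) s≡v)) values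
                  ∷ unique
    where
    base-special′ : ∀ c → entry (suc m) zeros zeros (true , odd (suc (suc m))) c ≡ special (suc m) (suc c)
    base-special′ = base-special (suc m) (odd (suc (suc m)))
  ...   | false = unique

flip-induction : ∀ {n} (Q : Vec Bool n → Set) → Q (replicate n false) → (∀ x t → Q x → Q (flipBit x t)) →
                 ∀ x → Q x
flip-induction {zero}  Q q₀ step []           = q₀
flip-induction {suc n} Q q₀ step (b ∷ x)
  with flip-induction (λ x′ → Q (false ∷ x′)) q₀ (λ x′ t → step (false ∷ x′) (Fin.suc t)) x
... | q with b
...   | false = q
...   | true  = step (false ∷ x) Fin.zero q

vec-ext : ∀ {n} (x y : Vec Bool n) → (∀ i → lookup x i ≡ lookup y i) → x ≡ y
vec-ext x y p = trans (sym (tabulate∘lookup x)) (trans (tabulate-cong p) (tabulate∘lookup y))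

flipBit-≢ : ∀ {n} (x : Vec Bool n) t → x ≢ flipBit x t
flipBit-≢ x t e = not-¬ refl (trans (cong (λ v → lookup v t) e) (lookup∘updateAt t x))

cubeAdj-flipBit : ∀ {n} (x : Vec Bool n) t → CubeAdj x (flipBit x t)
cubeAdj-flipBit x t =
  t , not-¬ refl ∘ (λ e → trans e (lookup∘updateAt t x)) , (λ i i≢t → sym (lookup∘updateAt′ i t i≢t x))

cubeAdj⇒flipBit : ∀ {n} (x y : Vec Bool n) → CubeAdj x y → ∃[ t ] y ≡ flipBit x t
cubeAdj⇒flipBit x y (t , differ , agree) = t , vec-ext y (flipBit x t) same
  where
  same : ∀ i → lookup y i ≡ lookup (flipBit x t) i
  same i with i Fin.≟ t
  ... | yes refl = trans (¬-not (differ ∘ sym)) (sym (lookup∘updateAt t x))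
  ... | no  i≢t  = trans (sym (agree i i≢t)) (sym (lookup∘updateAt′ i t i≢t x))

cube-criterion : ∀ {n} (f : Vec Bool n → Tableau) →
                 (∀ x S → Elementary (f x) S → S ≡ f x ⊎ ∃[ t ] S ≡ f (flipBit x t)) →
                 (∀ x t → Elementary (f x) (f (flipBit x t))) →
                 (∀ x y → f x ≡ f y → x ≡ y) →
                 IsoToCube n (f (replicate n false))
cube-criterion {n} f moves flips injective = f , reach , onlyVertices , injective , adjacency
  where
  reach : ∀ x → Isotopic (f (replicate n false)) (f x)
  reach = flip-induction _ ε⋆ (λ x t path → path ◅◅ (flips x t ◅ ε⋆))
  stays : ∀ x S → Isotopic (f x) S → ∃[ y ] f y ≡ S
  stays x .(f x) ε⋆             = x , refl
  stays x S      (step ◅ path) with moves x _ step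
  ... | inj₁ refl      = stays x S path
  ... | inj₂ (t , refl) = stays (flipBit x t) S path
  onlyVertices : ∀ S → Isotopic (f (replicate n false)) S → ∃[ x ] f x ≡ S
  onlyVertices = stays (replicate n false)
  adjacency : ∀ x y → (Adjacent (f x) (f y) → CubeAdj x y) × (CubeAdj x y → Adjacent (f x) (f y))
  adjacency x y = toCube , fromCube
    where
    toCube : Adjacent (f x) (f y) → CubeAdj x y
    toCube (fx≢fy , step) with moves x (f y) step
    ... | inj₁ fy≡fx  = ⊥-elim (fx≢fy (sym fy≡fx))
    ... | inj₂ (t , e) = subst (CubeAdj x) (sym (injective y (flipBit x t) e)) (cubeAdj-flipBit x t)
    fromCube : CubeAdj x y → Adjacent (f x) (f y)
    fromCube adj with cubeAdj⇒flipBit x y adj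
    ... | t , refl = (λ e → flipBit-≢ x t (injective x (flipBit x t) e)) , flips x t

first : Bool → ℕ
first false = 1
first true  = 2

line : Vec Bool 1 → Tableau
line (b ∷ []) = (first b ∷ first (not b) ∷ []) ∷ []

line-exchanged : ∀ b → (first (not b) ∷ first b ∷ []) ∷ [] ≡ line (not b ∷ [])
line-exchanged false = refl
line-exchanged true  = refl

line-members : ∀ b y → occ (line (b ∷ [])) y ≢ 0 → y ≡ first b ⊎ y ≡ first (not b)
line-members b y present with y ≡ᵇ first b in e₁
... | true  = inj₁ (≡ᵇ≡true⇒≡ y _ e₁)
... | false with y ≡ᵇ first (not b) in e₂
...   | true  = inj₂ (≡ᵇ≡true⇒≡ y _ e₂)
...   | false = ⊥-elim (present refl)

line-entries-exchanged : ∀ b → swapEntries (first b) (first (not b)) (line (b ∷ [])) ≡ line (not b ∷ [])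
                             × swapEntries (first (not b)) (first b) (line (b ∷ [])) ≡ line (not b ∷ [])
line-entries-exchanged false = refl , refl
line-entries-exchanged true  = refl , refl

line-moves : ∀ x S → Elementary (line x) S → S ≡ line x ⊎ ∃[ t ] S ≡ line (flipBit x t)
line-moves (b ∷ []) S (rowSwap zero    zero    _       _       _) = inj₁ refl
line-moves (b ∷ []) S (rowSwap (suc i) _       (s≤s ()) _      _)
line-moves (b ∷ []) S (rowSwap zero    (suc j) _       (s≤s ()) _)
line-moves (b ∷ []) S (colSwap zero          zero          _ _ _) = inj₁ refl
line-moves (b ∷ []) S (colSwap (suc zero)    (suc zero)    _ _ _) = inj₁ refl
line-moves (b ∷ []) S (colSwap zero          (suc zero)    _ _ _) = inj₂ (Fin.zero , line-exchanged b)
line-moves (b ∷ []) S (colSwap (suc zero)    zero          _ _ _) = inj₂ (Fin.zero , line-exchanged b)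
line-moves (b ∷ []) S (colSwap (suc (suc u)) _             () _ _)
line-moves (b ∷ []) S (colSwap zero          (suc (suc v)) _ () _)
line-moves (b ∷ []) S (colSwap (suc zero)    (suc (suc v)) _ () _)
line-moves (b ∷ []) S (entrySwap y z e) with occ (line (b ∷ [])) y ≟ 0 | y ≟ z
... | yes absent  | _        = inj₁ (swapEntries-absent y z _ absent (trans (sym e) absent))
... | no  _       | yes refl = inj₁ (swapEntries-same y _)
... | no  present | no  y≢z
  with line-members b y present | line-members b z (λ z0 → present (trans e z0))
...   | inj₁ refl | inj₁ refl = ⊥-elim (y≢z refl)
...   | inj₁ refl | inj₂ refl = inj₂ (Fin.zero , proj₁ (line-entries-exchanged b))
...   | inj₂ refl | inj₁ refl = inj₂ (Fin.zero , proj₂ (line-entries-exchanged b))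
...   | inj₂ refl | inj₂ refl = ⊥-elim (y≢z refl)

line-flips : ∀ x t → Elementary (line x) (line (flipBit x t))
line-flips (b ∷ []) Fin.zero =
  subst (Elementary (line (b ∷ []))) (line-exchanged b) (colSwap 0 1 (s≤s z≤n) (s≤s z≤n) refl)

line-injective : ∀ x y → line x ≡ line y → x ≡ y
line-injective (false ∷ []) (false ∷ []) _ = refl
line-injective (true  ∷ []) (true  ∷ []) _ = refl

line-latin : LatinTableau (line (false ∷ []))
line-latin = ((s≤s z≤n ∷ []) , [-]) , (↭-refl ∷ []) , columns
  where
  columns : ∀ c → Unique (column (line (false ∷ [])) c)
  columns zero          = [] ∷ []
  columns (suc zero)    = [] ∷ []
  columns (suc (suc c)) = []

vertex-origin : ∀ ε m → vertex ε m (replicate (dim ε m) false) ≡ tableau ε m zeros zeros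
vertex-origin ε m = tableau-cong ε m _ _ _ _
  (λ j → trans (cong ((j <ᵇ m) ∧_) (bit-zeros (dim ε m) j)) (∧-zeroʳ _))
  (λ k → bit-zeros (dim ε m) (m + k))
  where
  bit-zeros : ∀ n i → bit (replicate n false) i ≡ false
  bit-zeros zero    i       = refl
  bit-zeros (suc n) zero    = refl
  bit-zeros (suc n) (suc i) = bit-zeros n i

family-cube : ∀ ε m → ∃[ T ] (LatinTableau T × IsoToCube (dim ε (suc m)) T)
family-cube ε m =
  vertex ε (suc m) (replicate (dim ε (suc m)) false) ,
  subst LatinTableau (sym (vertex-origin ε (suc m))) (base-latin ε m) ,
  cube-criterion (vertex ε (suc m)) (vertex-moves ε (suc m)) (vertex-flip-move ε (suc m)) (vertex-injective ε (suc m))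

dim-suc : ∀ ε m → dim ε (suc m) ≡ suc (suc (dim ε m))
dim-suc false m = cong suc (+-suc m m)
dim-suc true  m = cong suc (+-suc m (suc m))

dim-onto : ∀ n → ∃[ ε ] ∃[ m ] dim ε (suc m) ≡ suc (suc n)
dim-onto zero          = false , 0 , refl
dim-onto (suc zero)    = true , 0 , refl
dim-onto (suc (suc n)) with dim-onto n
... | ε , m , e = ε , suc m , trans (dim-suc ε (suc m)) (cong (suc ∘ suc) e)

theorem5p9 : ∀ (d : ℕ) → 1 ≤ d → ∃[ T ] (LatinTableau T × IsoToCube d T)
theorem5p9 (suc zero)    _ = line (false ∷ []) , line-latin , cube-criterion line line-moves line-flips line-injective
theorem5p9 (suc (suc n)) _ with dim-onto n
... | ε , m , e = subst (λ d → ∃[ T ] (LatinTableau T × IsoToCube d T)) e (family-cube ε m)
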